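{- Let $\mathcal{M}$ be a molecule derivable in $\mathrm{ISC}$. Then there is a canonical derivation of $\mathcal{M}$ in $\mathrm{ISC}$.
   Context: Formulas are generated by $\sigma ::= a \mid \sigma\to\sigma \mid \sigma\wedge\sigma \mid \sigma\cap\sigma$, where $a$ ranges over a countable set of propositional variables. A context is a finite sequence of formulas. An atom $(\Gamma;\sigma)$ is a pair of a context and a formula. A molecule is a finite multiset of atoms all of whose contexts have the same length; we write $[(\Gamma_i;\sigma_i)\mid i\in I]$ or $[(\Gamma_i;\sigma_i)]_i$, and $\cup$ denotes multiset union. Commas in contexts denote concatenation. The system $\mathrm{ISC}$ derives molecules by the following rules (in "global" rules all molecules are indexed by the same finite set $I$): (Ax) $[(\alpha_i;\alpha_i)\mid i\in I]$ with no premise. (cut) from $[(\Gamma_i;\alpha_i)]_i$ and $[(\Delta_i,\alpha_i,\dots,\alpha_i;\beta_i)]_i$ (with $m\ge 1$ copies of $\alpha_i$) infer $[(\Gamma_i,\Delta_i;\beta_i)]_i$. (W) from $[(\Gamma_i;\beta_i)]_i$ infer $[(\Gamma_i,\alpha_i;\beta_i)]_i$. (X) from $[(\Gamma_i,\beta_i,\alpha_i,\Delta_i;\gamma_i)]_i$ infer $[(\Gamma_i,\alpha_i,\beta_i,\Delta_i;\gamma_i)]_i$. (C) from $[(\Gamma_i,\alpha_i,\alpha_i;\beta_i)]_i$ infer $[(\Gamma_i,\alpha_i;\beta_i)]_i$. (Fus) from $[(\Gamma;\beta)]\cup\mathcal{M}$ infer $[(\Gamma;\beta),(\Gamma;\beta)]\cup\mathcal{M}$.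 (P) from $\mathcal{M}\cup\mathcal{N}$ infer $\mathcal{M}$. ($\to$L) from $[(\Gamma_i;\alpha_i)]_i$ and $[(\Delta_i,\beta_i;\gamma_i)]_i$ infer $[(\Gamma_i,\Delta_i,\alpha_i\to\beta_i;\gamma_i)]_i$. ($\to$R) from $[(\Gamma_i,\alpha_i;\beta_i)]_i$ infer $[(\Gamma_i;\alpha_i\to\beta_i)]_i$. ($\wedge$L) from $[(\Gamma_i,\alpha^L_i,\alpha^R_i;\beta_i)]_i$ infer $[(\Gamma_i,\alpha^L_i\wedge\alpha^R_i;\beta_i)]_i$. ($\wedge$R) from $[(\Gamma_i;\alpha_i)]_i$ and $[(\Delta_i;\beta_i)]_i$ infer $[(\Gamma_i,\Delta_i;\alpha_i\wedge\beta_i)]_i$. ($\cap$L$_k$), $k\in\{L,R\}$: from $[(\Gamma,\alpha_k;\beta)]\cup\mathcal{M}$ infer $[(\Gamma,\alpha_L\cap\alpha_R;\beta)]\cup\mathcal{M}$. ($\cap$R) from $[(\Gamma;\alpha),(\Gamma;\beta)]\cup\mathcal{M}$ infer $[(\Gamma;\alpha\cap\beta)]\cup\mathcal{M}$. A formula is canonical if its principal (outermost) connective is not $\cap$. A derivation in $\mathrm{ISC}$ is canonical if every formula introduced by an application of (Ax) (i.e. each $\alpha_i$ in an axiom $[(\alpha_i;\alpha_i)\mid i\in I]$) and every formula introduced by an application of (W) (the added $\alpha_i$) is canonical. -}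

module Defs where

open import Data.Nat using (ℕ; suc)
open import Data.List using (List; []; _∷_; _++_; [_]; map; replicate)
open import Data.List.Relation.Unary.All using (All)
open import Data.List.Relation.Binary.Permutation.Propositional using (_↭_)
open import Data.Product using (_×_; _,_)
open import Data.Unit using (⊤)
open import Data.Empty using (⊥)

infixr 6 _⇒_
infixr 7 _∧_ _∩_

data Formula : Set where
  var : ℕ → Formula
  _⇒_ : Formula → Formula → Formula
  _∧_ : Formula → Formula → Formula
  _∩_ : Formula → Formula → Formula

Context : Set
Context = List Formula

Atom : Set
Atom = Context × Formula

-- A molecule is a finite multiset of atoms, represented as a list taken
-- up to permutation (rule perm below).  The equal-context-length condition
-- is automatically preserved by all rules.
Molecule : Set
Molecule = List Atom

IsCanonical : Formula → Set
IsCanonical (_ ∩ _) = ⊥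
IsCanonical _       = ⊤

-- Instance data for the "global" rules: one record per index i ∈ I;
-- a global rule takes a list of instances (I = its positions).

record CutI : Set where
  constructor cutI
  field Γ Δ : Context
        α β : Formula

record WI : Set where
  constructor wI
  field Γ : Context
        α β : Formula

record XI : Set where
  constructor xI
  field Γ : Context
        β α : Formula
        Δ : Context
        γ : Formula

record CI : Set where
  constructor cI
  field Γ : Context
        α β : Formula

record ImpLI : Set where
  constructor impLI
  field Γ Δ : Context
        α β γ : Formula

record ImpRI : Set where
  constructor impRI
  field Γ : Context
        α β : Formula

record AndLI : Set where
  constructor andLI
  field Γ : Context
        αL αR β : Formula

record AndRI : Set where
  constructor andRI
  field Γ Δ : Context
        α β : Formula

data Side : Set where
  L R : Side

pick : Side → Formula → Formula → Formula
pick L a b = a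
pick R a b = b

-- Derivations in ISC (proof-relevant, so that canonicity of a derivation
-- can be expressed).
data Deriv : Molecule → Set where
  perm : ∀ {M N} → Deriv M → M ↭ N → Deriv N
  ax   : (αs : List Formula) → Deriv (map (λ α → ([ α ] , α)) αs)
  cut  : (m : ℕ) (is : List CutI) →
         Deriv (map (λ i → (CutI.Γ i , CutI.α i)) is) →
         Deriv (map (λ i → (CutI.Δ i ++ replicate (suc m) (CutI.α i) , CutI.β i)) is) →
         Deriv (map (λ i → (CutI.Γ i ++ CutI.Δ i , CutI.β i)) is)
  weak : (is : List WI) →
         Deriv (map (λ i → (WI.Γ i , WI.β i)) is) →
         Deriv (map (λ i → (WI.Γ i ++ [ WI.α i ] , WI.β i)) is)
  exch : (is : List XI) →
         Deriv (map (λ i → (XI.Γ i ++ XI.β i ∷ XI.α i ∷ XI.Δ i , XI.γ i)) is) →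
         Deriv (map (λ i → (XI.Γ i ++ XI.α i ∷ XI.β i ∷ XI.Δ i , XI.γ i)) is)
  contr : (is : List CI) →
         Deriv (map (λ i → (CI.Γ i ++ CI.α i ∷ CI.α i ∷ [] , CI.β i)) is) →
         Deriv (map (λ i → (CI.Γ i ++ [ CI.α i ] , CI.β i)) is)
  fus  : ∀ Γ β M → Deriv ((Γ , β) ∷ M) → Deriv ((Γ , β) ∷ (Γ , β) ∷ M)
  prun : ∀ M N → Deriv (M ++ N) → Deriv M
  impL : (is : List ImpLI) →
         Deriv (map (λ i → (ImpLI.Γ i , ImpLI.α i)) is) →
         Deriv (map (λ i → (ImpLI.Δ i ++ [ ImpLI.β i ] , ImpLI.γ i)) is) →
         Deriv (map (λ i → (ImpLI.Γ i ++ ImpLI.Δ i ++ [ ImpLI.α i ⇒ ImpLI.β i ] , ImpLI.γ i)) is)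
  impR : (is : List ImpRI) →
         Deriv (map (λ i → (ImpRI.Γ i ++ [ ImpRI.α i ] , ImpRI.β i)) is) →
         Deriv (map (λ i → (ImpRI.Γ i , ImpRI.α i ⇒ ImpRI.β i)) is)
  andL : (is : List AndLI) →
         Deriv (map (λ i → (AndLI.Γ i ++ AndLI.αL i ∷ AndLI.αR i ∷ [] , AndLI.β i)) is) →
         Deriv (map (λ i → (AndLI.Γ i ++ [ AndLI.αL i ∧ AndLI.αR i ] , AndLI.β i)) is)
  andR : (is : List AndRI) →
         Deriv (map (λ i → (AndRI.Γ i , AndRI.α i)) is) →
         Deriv (map (λ i → (AndRI.Δ i , AndRI.β i)) is) →
         Deriv (map (λ i → (AndRI.Γ i ++ AndRI.Δ i , AndRI.α i ∧ AndRI.β i)) is)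
  capL : (k : Side) → ∀ Γ αL αR β M →
         Deriv ((Γ ++ [ pick k αL αR ] , β) ∷ M) →
         Deriv ((Γ ++ [ αL ∩ αR ] , β) ∷ M)
  capR : ∀ Γ α β M →
         Deriv ((Γ , α) ∷ (Γ , β) ∷ M) →
         Deriv ((Γ , α ∩ β) ∷ M)

Canonical : ∀ {M} → Deriv M → Set
Canonical (perm d _)      = Canonical d
Canonical (ax αs)         = All IsCanonical αs
Canonical (cut m is d e)  = Canonical d × Canonical e
Canonical (weak is d)     = All (λ i → IsCanonical (WI.α i)) is × Canonical d
Canonical (exch is d)     = Canonical d
Canonical (contr is d)    = Canonical d
Canonical (fus Γ β M d)   = Canonical d
Canonical (prun M N d)    = Canonical d
Canonical (impL is d e)   = Canonical d × Canonical e
Canonical (impR is d)     = Canonical d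
Canonical (andL is d)     = Canonical d
Canonical (andR is d e)   = Canonical d × Canonical e
Canonical (capL k Γ αL αR β M d) = Canonical d
Canonical (capR Γ α β M d) = Canonical d

module Submission where

open import Defs
open import Function using (_∘_)
open import Data.Product using (Σ; _,_)
open import Data.List using (List; []; _∷_; _++_; [_]; map; concatMap)
open import Data.List.Properties
  using (map-++; ++-assoc; ++-identityʳ; map-∘; concatMap-map; concatMap-pure; map-concatMap)
open import Data.List.Relation.Unary.All using (All; []; _∷_)
open import Data.List.Relation.Unary.All.Properties using (map⁺; ++⁺)
open import Data.List.Relation.Binary.Permutation.Propositional using (_↭_; ↭-sym; ↭-refl; ↭-reflexive; swap)
open import Data.List.Relation.Binary.Permutation.Propositional.Properties using (shift; shifts)
open import Relation.Binary.PropositionalEquality using (_≡_; sym; trans; subst; cong)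
open import Data.Unit using (tt)

-- Only (Ax) and (W) can introduce a non-canonical formula, so it suffices to
-- replace those two rules.  The axiom on α ∩ β follows from the axioms on α
-- and β by (∩L_L), (∩L_R) and (∩R); weakening by α ∩ β follows from
-- weakening by α and (∩L_L).  Iterating down the ∩-structure of the formula
-- reaches canonical formulas.

CanonicalDeriv : Molecule → Set
CanonicalDeriv M = Σ (Deriv M) Canonical

reorder : ∀ {M N} → M ↭ N → CanonicalDeriv M → CanonicalDeriv N
reorder p (d , c) = perm d p , c

cast : ∀ {M N} → M ≡ N → CanonicalDeriv M → CanonicalDeriv N
cast = subst CanonicalDeriv

concatMap-singleton : {A B : Set} (h : A → B) (xs : List A) →
                      concatMap (λ x → [ h x ]) xs ≡ map h xs
concatMap-singleton h xs = trans (sym (concatMap-map [_] h xs)) (concatMap-pure (map h xs))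

-- The ∩-rules act only on the first atom of a molecule; since molecules are
-- multisets, each block can in turn be brought to the front.
module _ {A : Set} (f g : A → Molecule)
         (step : ∀ a M → CanonicalDeriv (f a ++ M) → CanonicalDeriv (g a ++ M)) where

  replace-blocks : ∀ xs M → CanonicalDeriv (concatMap f xs ++ M) →
                   CanonicalDeriv (concatMap g xs ++ M)
  replace-blocks [] M d = d
  replace-blocks (x ∷ xs) M d =
    cast (sym (++-assoc (g x) (concatMap g xs) M))
      (reorder (shifts (concatMap g xs) (g x))
        (replace-blocks xs (g x ++ M)
          (reorder (shifts (g x) (concatMap f xs))
            (step x (concatMap f xs ++ M)
              (cast (++-assoc (f x) (concatMap f xs) M) d)))))

∩-leaves : Formula → List Formula
∩-leaves (α ∩ β) = ∩-leaves α ++ ∩-leaves β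
∩-leaves α       = [ α ]

∩-leaves-canonical : ∀ α → All IsCanonical (∩-leaves α)
∩-leaves-canonical (var n) = tt ∷ []
∩-leaves-canonical (α ⇒ β) = tt ∷ []
∩-leaves-canonical (α ∧ β) = tt ∷ []
∩-leaves-canonical (α ∩ β) = ++⁺ (∩-leaves-canonical α) (∩-leaves-canonical β)

ax-molecule : List Formula → Molecule
ax-molecule = map (λ α → ([ α ] , α))

∩-axiom : ∀ α β M → CanonicalDeriv (([ β ] , β) ∷ ([ α ] , α) ∷ M) →
          CanonicalDeriv (([ α ∩ β ] , α ∩ β) ∷ M)
∩-axiom α β M (d , c) =
  capR [ α ∩ β ] α β M
    (capL L [] α β α (([ α ∩ β ] , β) ∷ M)
      (perm (capL R [] α β β (([ α ] , α) ∷ M) d)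
            (swap _ _ ↭-refl)))
  , c

ax-from-∩-leaves : ∀ α M → CanonicalDeriv (ax-molecule (∩-leaves α) ++ M) →
                   CanonicalDeriv (ax-molecule [ α ] ++ M)
ax-from-∩-leaves (var n) M d = d
ax-from-∩-leaves (α ⇒ β) M d = d
ax-from-∩-leaves (α ∧ β) M d = d
ax-from-∩-leaves (α ∩ β) M d =
  ∩-axiom α β M
    (ax-from-∩-leaves β (([ α ] , α) ∷ M)
      (reorder (↭-sym (shift _ (ax-molecule (∩-leaves β)) M))
        (ax-from-∩-leaves α (ax-molecule (∩-leaves β) ++ M)
          (cast (trans (cong (_++ M) (map-++ _ (∩-leaves α) (∩-leaves β)))
                       (++-assoc (ax-molecule (∩-leaves α)) _ M))
            d))))

ax-canonical : ∀ αs → CanonicalDeriv (ax-molecule αs)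
ax-canonical αs =
  cast (trans (cong (_++ []) (concatMap-singleton (λ α → ([ α ] , α)) αs)) (++-identityʳ _))
    (replace-blocks (ax-molecule ∘ ∩-leaves) (ax-molecule ∘ [_]) ax-from-∩-leaves αs []
      (cast (trans (map-concatMap _ ∩-leaves αs) (sym (++-identityʳ _)))
        (ax (concatMap ∩-leaves αs) , leaves-canonical αs)))
  where
  leaves-canonical : ∀ αs → All IsCanonical (concatMap ∩-leaves αs)
  leaves-canonical []       = []
  leaves-canonical (α ∷ αs) = ++⁺ (∩-leaves-canonical α) (leaves-canonical αs)

∩-head : Formula → Formula
∩-head (α ∩ β) = ∩-head α
∩-head α       = α

∩-head-canonical : ∀ α → IsCanonical (∩-head α)
∩-head-canonical (var n) = tt
∩-head-canonical (α ⇒ β) = tt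
∩-head-canonical (α ∧ β) = tt
∩-head-canonical (α ∩ β) = ∩-head-canonical α

capL-∩-head : ∀ α Γ β M → CanonicalDeriv ((Γ ++ [ ∩-head α ] , β) ∷ M) →
              CanonicalDeriv ((Γ ++ [ α ] , β) ∷ M)
capL-∩-head (var n) Γ β M d = d
capL-∩-head (α ⇒ α′) Γ β M d = d
capL-∩-head (α ∧ α′) Γ β M d = d
capL-∩-head (α ∩ α′) Γ β M d with capL-∩-head α Γ β M d
... | d′ , c = capL L Γ α α′ β M d′ , c

weak-∩-head : ∀ is → CanonicalDeriv (map (λ i → (WI.Γ i , WI.β i)) is) →
              CanonicalDeriv (map (λ i → (WI.Γ i ++ [ ∩-head (WI.α i) ] , WI.β i)) is)
weak-∩-head is (d , c) =
  cast (sym (map-∘ is))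
    (weak (map head-instance is) (perm d (↭-reflexive (map-∘ is)))
    , map⁺ (all-∩-head is) , c)
  where
  head-instance : WI → WI
  head-instance (wI Γ α β) = wI Γ (∩-head α) β
  all-∩-head : ∀ is → All (IsCanonical ∘ WI.α ∘ head-instance) is
  all-∩-head []       = []
  all-∩-head (i ∷ is) = ∩-head-canonical (WI.α i) ∷ all-∩-head is

weak-canonical : ∀ is → CanonicalDeriv (map (λ i → (WI.Γ i , WI.β i)) is) →
                 CanonicalDeriv (map (λ i → (WI.Γ i ++ [ WI.α i ] , WI.β i)) is)
weak-canonical is d =
  cast (trans (cong (_++ []) (concatMap-singleton weakened is)) (++-identityʳ _))
    (replace-blocks ([_] ∘ head-weakened) ([_] ∘ weakened)
      (λ i → capL-∩-head (WI.α i) (WI.Γ i) (WI.β i)) is []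
      (cast (trans (sym (concatMap-singleton head-weakened is)) (sym (++-identityʳ _)))
        (weak-∩-head is d)))
  where
  weakened head-weakened : WI → Atom
  weakened      (wI Γ α β) = Γ ++ [ α ] , β
  head-weakened (wI Γ α β) = Γ ++ [ ∩-head α ] , β

lemma5p1 : (M : Molecule) → Deriv M → Σ (Deriv M) Canonical
lemma5p1 _ (ax αs)     = ax-canonical αs
lemma5p1 _ (weak is d) = weak-canonical is (lemma5p1 _ d)
lemma5p1 _ (perm d p)  = reorder p (lemma5p1 _ d)
lemma5p1 _ (cut m is d e) =
  let (d′ , c) = lemma5p1 _ d ; (e′ , c′) = lemma5p1 _ e in cut m is d′ e′ , c , c′
lemma5p1 _ (impL is d e) =
  let (d′ , c) = lemma5p1 _ d ; (e′ , c′) = lemma5p1 _ e in impL is d′ e′ , c , c′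
lemma5p1 _ (andR is d e) =
  let (d′ , c) = lemma5p1 _ d ; (e′ , c′) = lemma5p1 _ e in andR is d′ e′ , c , c′
lemma5p1 _ (exch is d)    = let (d′ , c) = lemma5p1 _ d in exch is d′ , c
lemma5p1 _ (contr is d)   = let (d′ , c) = lemma5p1 _ d in contr is d′ , c
lemma5p1 _ (fus Γ β M d)  = let (d′ , c) = lemma5p1 _ d in fus Γ β M d′ , c
lemma5p1 _ (prun M N d)   = let (d′ , c) = lemma5p1 _ d in prun M N d′ , c
lemma5p1 _ (impR is d)    = let (d′ , c) = lemma5p1 _ d in impR is d′ , c
lemma5p1 _ (andL is d)    = let (d′ , c) = lemma5p1 _ d in andL is d′ , c
lemma5p1 _ (capL k Γ αL αR β M d) = let (d′ , c) = lemma5p1 _ d in capL k Γ αL αR β M d′ , c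
lemma5p1 _ (capR Γ α β M d)       = let (d′ , c) = lemma5p1 _ d in capR Γ α β M d′ , c
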